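{- If a graph $G$ has a unit-cube contact representation $\Gamma$ in which one face of each cube is co-planar (all these faces lie in a common plane), then every threshold subgraph of $G$ also has a unit-cube contact representation.
   Context: A unit-cube contact representation of a graph $G$ assigns to each vertex an axis-aligned unit cube in $\mathbb{R}^3$ such that the cubes have pairwise disjoint interiors, and two cubes share a boundary region of non-zero area if and only if the corresponding vertices are adjacent. For a graph $G=(V,E)$, integers $r\ge1,t\ge0$ and an edge-labeling $\ell:E\to\{N,F\}$, an $(r,t)$-threshold-coloring with respect to $\ell$ is a map $c:V\to\{1,\dots,r\}$ such that for every edge $uv\in E$: $\ell(uv)=N$ iff $|c(u)-c(v)|\le t$. A spanning subgraph $H=(V,E_H)$ of $G$ is a threshold subgraph of $G$ if for some $r\ge1,t\ge0$ there is an $(r,t)$-threshold-coloring of $G$ with respect to the labeling whose near edges are exactly $E_H$.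
   Formalization: The cubes of both unit-cube contact representations, the given one of G and the one sought for the threshold subgraph, have rational corner coordinates, lying in ℚ^3 rather than $\mathbb{R}^3$. -}

module Defs where

open import Data.Nat as ℕ using (ℕ)
open import Data.Fin using (Fin)
open import Data.Rational as ℚ using (ℚ; 1ℚ; ∣_∣)
open import Data.Product using (Σ; ∃; ∃-syntax; Σ-syntax; _×_)
open import Data.Sum using (_⊎_)
open import Relation.Binary.PropositionalEquality using (_≡_; _≢_)
open import Relation.Nullary using (¬_)
open import Function.Bundles using (_⇔_)

record Graph (n : ℕ) : Set₁ where
  field
    Adj   : Fin n → Fin n → Set
    sym   : ∀ {u v} → Adj u v → Adj v u
    irrefl : ∀ {v} → ¬ Adj v v
open Graph public

SpanningSubgraph : ∀ {n} → Graph n → Graph n → Set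
SpanningSubgraph {n} H G = ∀ {u v : Fin n} → Adj H u v → Adj G u v

IsThresholdSubgraph : ∀ {n} → Graph n → Graph n → Set
IsThresholdSubgraph {n} H G =
  SpanningSubgraph H G ×
  Σ[ r ∈ ℕ ] Σ[ t ∈ ℕ ] Σ[ c ∈ (Fin n → ℕ) ] (1 ℕ.≤ r ×
    (∀ v → 1 ℕ.≤ c v × c v ℕ.≤ r) ×
    (∀ u v → Adj G u v → (Adj H u v ⇔ ℕ.∣ c u - c v ∣ ℕ.≤ t)))

-- An axis-aligned unit cube in 3-space is given by its minimal corner p;
-- it occupies [p 0, p 0 + 1] × [p 1, p 1 + 1] × [p 2, p 2 + 1].
Point : Set
Point = Fin 3 → ℚ

-- Interiors of the unit cubes at p and q are disjoint
-- (the open intervals are disjoint along some axis).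
InteriorDisjoint : Point → Point → Set
InteriorDisjoint p q = ∃[ i ] 1ℚ ℚ.≤ ∣ p i ℚ.- q i ∣

-- The two unit cubes (with disjoint interiors) share a boundary region of
-- non-zero area: their intersection is a rectangle of positive area, i.e.
-- along one axis they touch (distance exactly 1) and along the other two
-- axes their projections overlap in an interval of positive length.
FaceContact : Point → Point → Set
FaceContact p q =
  ∃[ i ] (∣ p i ℚ.- q i ∣ ≡ 1ℚ × (∀ j → j ≢ i → ∣ p j ℚ.- q j ∣ ℚ.< 1ℚ))

IsUnitCubeContactRep : ∀ {n} → Graph n → (Fin n → Point) → Set
IsUnitCubeContactRep {n} G pos =
  (∀ u v → u ≢ v → InteriorDisjoint (pos u) (pos v)) ×
  (∀ u v → u ≢ v → (Adj G u v ⇔ FaceContact (pos u) (pos v)))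

HasUnitCubeContactRep : ∀ {n} → Graph n → Set
HasUnitCubeContactRep G = ∃[ pos ] IsUnitCubeContactRep G pos

-- One face of each cube lies in a common plane: there is an axis i such that
-- all cubes have the same coordinate along i (all cubes stand on the plane
-- x_i = h, each with its i-minimal face in that plane).
CoplanarFaces : ∀ {n} → (Fin n → Point) → Set
CoplanarFaces {n} pos = ∃[ i ] ∃[ h ] (∀ (v : Fin n) → pos v i ≡ h)

-- All cubes stand on a common plane x_i = h, so every contact of G is across one of the
-- other two axes, and the i-coordinate of each cube is free. Lift the cube of v to height
-- c(v)/(t+1) along axis i: interiors stay disjoint, and two cubes that touched keep a
-- contact of positive area exactly when their heights differ by less than 1, that is,
-- exactly when |c(u) - c(v)| ≤ t.
module Submission where

open import Data.Nat as ℕ using (ℕ; zero; suc; z≤n; s≤s)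
import Data.Nat.Properties as ℕ
open import Data.Fin using (Fin; _≟_)
open import Data.Rational as ℚ
  using (ℚ; 0ℚ; 1ℚ; ∣_∣; _+_; _-_; -_; _*_; 1/_; _<_; _≤_; Positive; NonZero)
import Data.Rational.Properties as ℚ
open import Data.Rational.Solver using (module +-*-Solver)
open import Data.Product using (_×_; _,_; ∃-syntax)
open import Data.Product.Function.NonDependent.Propositional using (_×-⇔_)
open import Data.Sum using (inj₁; inj₂)
open import Data.Vec.Functional using (updateAt)
open import Data.Vec.Functional.Properties using (updateAt-updates; updateAt-minimal)
open import Function using (const; _∘_)
open import Function.Bundles using (_⇔_; mk⇔; Equivalence)
import Function.Properties.Equivalence as ⇔
open import Relation.Binary.PropositionalEquality
open import Relation.Nullary using (¬_; yes; no; contradiction)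

open import Defs hiding (sym)

fromℕ : ℕ → ℚ
fromℕ zero    = 0ℚ
fromℕ (suc n) = 1ℚ + fromℕ n

fromℕ-+ : ∀ m n → fromℕ (m ℕ.+ n) ≡ fromℕ m + fromℕ n
fromℕ-+ zero    n = sym (ℚ.+-identityˡ (fromℕ n))
fromℕ-+ (suc m) n = trans (cong (1ℚ +_) (fromℕ-+ m n)) (sym (ℚ.+-assoc 1ℚ (fromℕ m) (fromℕ n)))

fromℕ-nonNeg : ∀ n → 0ℚ ≤ fromℕ n
fromℕ-nonNeg zero    = ℚ.≤-refl
fromℕ-nonNeg (suc n) = ℚ.+-mono-≤ (ℚ.<⇒≤ (ℚ.positive⁻¹ 1ℚ)) (fromℕ-nonNeg n)

fromℕ-mono-≤ : ∀ {m n} → m ℕ.≤ n → fromℕ m ≤ fromℕ n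
fromℕ-mono-≤ {m} {n} m≤n = begin
  fromℕ m                   ≡⟨ ℚ.+-identityʳ (fromℕ m) ⟨
  fromℕ m + 0ℚ              ≤⟨ ℚ.+-monoʳ-≤ (fromℕ m) (fromℕ-nonNeg (n ℕ.∸ m)) ⟩
  fromℕ m + fromℕ (n ℕ.∸ m) ≡⟨ fromℕ-+ m (n ℕ.∸ m) ⟨
  fromℕ (m ℕ.+ (n ℕ.∸ m))   ≡⟨ cong fromℕ (ℕ.m+[n∸m]≡n m≤n) ⟩
  fromℕ n                   ∎
  where open ℚ.≤-Reasoning

fromℕ-mono-< : ∀ {m n} → m ℕ.< n → fromℕ m < fromℕ n
fromℕ-mono-< {m} m<n = ℚ.<-≤-trans fromℕ-m<1+fromℕ-m (fromℕ-mono-≤ m<n)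
  where
  fromℕ-m<1+fromℕ-m : fromℕ m < 1ℚ + fromℕ m
  fromℕ-m<1+fromℕ-m = subst (_< 1ℚ + fromℕ m) (ℚ.+-identityˡ (fromℕ m))
                            (ℚ.+-monoˡ-< (fromℕ m) (ℚ.positive⁻¹ 1ℚ))

fromℕ-cancel-< : ∀ {m n} → fromℕ m < fromℕ n → m ℕ.< n
fromℕ-cancel-< {m} {n} fm<fn = ℕ.≰⇒> λ n≤m → ℚ.<-irrefl refl (ℚ.<-≤-trans fm<fn (fromℕ-mono-≤ n≤m))

∣p-q∣≡∣q-p∣ : ∀ p q → ∣ p - q ∣ ≡ ∣ q - p ∣
∣p-q∣≡∣q-p∣ p q = trans (cong ∣_∣ (p-q≡-[q-p] p q)) (ℚ.∣-p∣≡∣p∣ (q - p))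
  where
  open +-*-Solver
  p-q≡-[q-p] : ∀ p q → p - q ≡ - (q - p)
  p-q≡-[q-p] = solve 2 (λ p q → p :- q := :- (q :- p)) refl

fromℕ-distance-≤ : ∀ {m n} → m ℕ.≤ n → ∣ fromℕ m - fromℕ n ∣ ≡ fromℕ (n ℕ.∸ m)
fromℕ-distance-≤ {m} {n} m≤n = begin
  ∣ fromℕ m - fromℕ n ∣                    ≡⟨ cong (λ k → ∣ fromℕ m - fromℕ k ∣) (ℕ.m+[n∸m]≡n m≤n) ⟨
  ∣ fromℕ m - fromℕ (m ℕ.+ (n ℕ.∸ m)) ∣     ≡⟨ cong (λ q → ∣ fromℕ m - q ∣) (fromℕ-+ m (n ℕ.∸ m)) ⟩
  ∣ fromℕ m - (fromℕ m + fromℕ (n ℕ.∸ m)) ∣ ≡⟨ cong ∣_∣ (p-[p+q]≡-q (fromℕ m) (fromℕ (n ℕ.∸ m))) ⟩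
  ∣ - fromℕ (n ℕ.∸ m) ∣                    ≡⟨ ℚ.∣-p∣≡∣p∣ (fromℕ (n ℕ.∸ m)) ⟩
  ∣ fromℕ (n ℕ.∸ m) ∣                      ≡⟨ ℚ.0≤p⇒∣p∣≡p (fromℕ-nonNeg (n ℕ.∸ m)) ⟩
  fromℕ (n ℕ.∸ m)                          ∎
  where
  open ≡-Reasoning
  open +-*-Solver
  p-[p+q]≡-q : ∀ p q → p - (p + q) ≡ - q
  p-[p+q]≡-q = solve 2 (λ p q → p :- (p :+ q) := :- q) refl

fromℕ-distance : ∀ m n → ∣ fromℕ m - fromℕ n ∣ ≡ fromℕ ℕ.∣ m - n ∣
fromℕ-distance m n with ℕ.≤-total m n
... | inj₁ m≤n = trans (fromℕ-distance-≤ m≤n) (cong fromℕ (sym (ℕ.m≤n⇒∣m-n∣≡n∸m m≤n)))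
... | inj₂ n≤m = begin
  ∣ fromℕ m - fromℕ n ∣ ≡⟨ ∣p-q∣≡∣q-p∣ (fromℕ m) (fromℕ n) ⟩
  ∣ fromℕ n - fromℕ m ∣ ≡⟨ fromℕ-distance-≤ n≤m ⟩
  fromℕ (m ℕ.∸ n)       ≡⟨ cong fromℕ (ℕ.m≤n⇒∣n-m∣≡n∸m n≤m) ⟨
  fromℕ ℕ.∣ m - n ∣     ∎
  where open ≡-Reasoning

fromℕ-suc-positive : ∀ n → Positive (fromℕ (suc n))
fromℕ-suc-positive n = ℚ.positive (fromℕ-mono-< (s≤s (z≤n {n})))

fromℕ-suc-nonZero : ∀ n → NonZero (fromℕ (suc n))
fromℕ-suc-nonZero n = ℚ.pos⇒nonZero (fromℕ (suc n)) {{fromℕ-suc-positive n}}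

step : ℕ → ℚ
step t = (1/ fromℕ (suc t)) {{fromℕ-suc-nonZero t}}

step-positive : ∀ t → Positive (step t)
step-positive t = ℚ.1/pos⇒pos (fromℕ (suc t)) {{fromℕ-suc-positive t}}

fromℕ-suc*step≡1 : ∀ t → fromℕ (suc t) * step t ≡ 1ℚ
fromℕ-suc*step≡1 t = ℚ.*-inverseʳ (fromℕ (suc t)) {{fromℕ-suc-nonZero t}}

scale : ℕ → ℕ → ℚ
scale t a = fromℕ a * step t

scale-distance : ∀ t a b → ∣ scale t a - scale t b ∣ ≡ fromℕ ℕ.∣ a - b ∣ * step t
scale-distance t a b = begin
  ∣ fromℕ a * step t - fromℕ b * step t ∣ ≡⟨ cong ∣_∣ (xz-yz≡[x-y]z (fromℕ a) (fromℕ b) (step t)) ⟩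
  ∣ (fromℕ a - fromℕ b) * step t ∣        ≡⟨ ℚ.∣p*q∣≡∣p∣*∣q∣ (fromℕ a - fromℕ b) (step t) ⟩
  ∣ fromℕ a - fromℕ b ∣ * ∣ step t ∣      ≡⟨ cong₂ _*_ (fromℕ-distance a b) ∣step∣≡step ⟩
  fromℕ ℕ.∣ a - b ∣ * step t              ∎
  where
  open ≡-Reasoning
  open +-*-Solver
  xz-yz≡[x-y]z : ∀ x y z → x * z - y * z ≡ (x - y) * z
  xz-yz≡[x-y]z = solve 3 (λ x y z → x :* z :- y :* z := (x :- y) :* z) refl
  ∣step∣≡step : ∣ step t ∣ ≡ step t
  ∣step∣≡step = ℚ.0≤p⇒∣p∣≡p (ℚ.<⇒≤ (ℚ.positive⁻¹ (step t) {{step-positive t}}))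

∣scale-scale∣<1⇔ : ∀ t a b → ∣ scale t a - scale t b ∣ < 1ℚ ⇔ ℕ.∣ a - b ∣ ℕ.≤ t
∣scale-scale∣<1⇔ t a b = mk⇔
  (λ close → ℕ.s≤s⁻¹ (fromℕ-cancel-< (*step-cancel-< (subst₂ _<_ distance 1≡[1+t]*step close))))
  (λ ∣a-b∣≤t → subst₂ _<_ (sym distance) (sym 1≡[1+t]*step) (*step-mono-< (fromℕ-mono-< (s≤s ∣a-b∣≤t))))
  where
  distance : ∣ scale t a - scale t b ∣ ≡ fromℕ ℕ.∣ a - b ∣ * step t
  distance = scale-distance t a b
  1≡[1+t]*step : 1ℚ ≡ fromℕ (suc t) * step t
  1≡[1+t]*step = sym (fromℕ-suc*step≡1 t)
  *step-mono-< : ∀ {p q} → p < q → p * step t < q * step t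
  *step-mono-< = ℚ.*-monoˡ-<-pos (step t) {{step-positive t}}
  *step-cancel-< : ∀ {p q} → p * step t < q * step t → p < q
  *step-cancel-< = ℚ.*-cancelʳ-<-nonNeg (step t) {{ℚ.pos⇒nonNeg (step t) {{step-positive t}}}}

-- Opaque so that p [ i ]≔ x does not unfold and its arguments stay inferable by unification.
opaque
  _[_]≔_ : Point → Fin 3 → ℚ → Point
  p [ i ]≔ x = updateAt p i (const x)

  []≔-here : ∀ p i x → (p [ i ]≔ x) i ≡ x
  []≔-here p i x = updateAt-updates i p

  []≔-there : ∀ p {i j} x → j ≢ i → (p [ i ]≔ x) j ≡ p j
  []≔-there p {i} {j} x j≢i = updateAt-minimal j i p j≢i

overlapping⇒¬interiorDisjoint : ∀ {p q} → (∀ j → ∣ p j - q j ∣ < 1ℚ) → ¬ InteriorDisjoint p q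
overlapping⇒¬interiorDisjoint close (j , 1≤∣pj-qj∣) = ℚ.<-irrefl refl (ℚ.≤-<-trans 1≤∣pj-qj∣ (close j))

module _ {p q : Point} {i : Fin 3} {x y : ℚ} where

  []≔-distance-here : ∣ (p [ i ]≔ x) i - (q [ i ]≔ y) i ∣ ≡ ∣ x - y ∣
  []≔-distance-here = cong₂ (λ a b → ∣ a - b ∣) ([]≔-here p i x) ([]≔-here q i y)

  []≔-distance-there : ∀ {j} → j ≢ i → ∣ (p [ i ]≔ x) j - (q [ i ]≔ y) j ∣ ≡ ∣ p j - q j ∣
  []≔-distance-there {j} j≢i =
    cong₂ (λ a b → ∣ a - b ∣) ([]≔-there p x j≢i) ([]≔-there q y j≢i)

module _ {p q : Point} {i : Fin 3} (coplanar : p i ≡ q i) where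

  coplanar-close : ∣ p i - q i ∣ < 1ℚ
  coplanar-close = subst (_< 1ℚ) (sym ∣pi-qi∣≡0) (ℚ.positive⁻¹ 1ℚ)
    where
    ∣pi-qi∣≡0 : ∣ p i - q i ∣ ≡ 0ℚ
    ∣pi-qi∣≡0 = trans (cong (λ a → ∣ p i - a ∣) (sym coplanar)) (cong ∣_∣ (ℚ.+-inverseʳ (p i)))

  close-off-axis : ∀ j → (j ≢ i → ∣ p j - q j ∣ < 1ℚ) → ∣ p j - q j ∣ < 1ℚ
  close-off-axis j off with j ≟ i
  ... | yes refl = coplanar-close
  ... | no j≢i   = off j≢i

  touching-axis≢ : ∀ {k} → ∣ p k - q k ∣ ≡ 1ℚ → k ≢ i
  touching-axis≢ ∣pk-qk∣≡1 refl = ℚ.<-irrefl ∣pk-qk∣≡1 coplanar-close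

  interiorDisjoint-[]≔ : ∀ {x y} → InteriorDisjoint p q → InteriorDisjoint (p [ i ]≔ x) (q [ i ]≔ y)
  interiorDisjoint-[]≔ (k , 1≤∣pk-qk∣) with k ≟ i
  ... | yes refl = contradiction (ℚ.≤-<-trans 1≤∣pk-qk∣ coplanar-close) (ℚ.<-irrefl refl)
  ... | no k≢i   = k , subst (1ℚ ≤_) (sym ([]≔-distance-there k≢i)) 1≤∣pk-qk∣

  faceContact-[]≔ : ∀ {x y} → InteriorDisjoint p q →
                    FaceContact (p [ i ]≔ x) (q [ i ]≔ y) ⇔ (FaceContact p q × ∣ x - y ∣ < 1ℚ)
  faceContact-[]≔ {x} {y} disjoint = mk⇔ to from
    where
    to : FaceContact (p [ i ]≔ x) (q [ i ]≔ y) → FaceContact p q × ∣ x - y ∣ < 1ℚ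
    to (k , touch , close) with k ≟ i
    ... | yes refl = contradiction disjoint (overlapping⇒¬interiorDisjoint {p} {q} λ j →
            close-off-axis j λ j≢i → subst (_< 1ℚ) ([]≔-distance-there j≢i) (close j j≢i))
    ... | no k≢i =
      (k , trans (sym ([]≔-distance-there k≢i)) touch , λ j j≢k →
         close-off-axis j λ j≢i → subst (_< 1ℚ) ([]≔-distance-there j≢i) (close j j≢k)) ,
      subst (_< 1ℚ) []≔-distance-here (close i (k≢i ∘ sym))
    from : FaceContact p q × ∣ x - y ∣ < 1ℚ → FaceContact (p [ i ]≔ x) (q [ i ]≔ y)
    from ((k , touch , close) , ∣x-y∣<1) =
      k , trans ([]≔-distance-there (touching-axis≢ touch)) touch , close′
      where
      close′ : ∀ j → j ≢ k → ∣ (p [ i ]≔ x) j - (q [ i ]≔ y) j ∣ < 1ℚ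
      close′ j j≢k with j ≟ i
      ... | yes refl = subst (_< 1ℚ) (sym []≔-distance-here) ∣x-y∣<1
      ... | no j≢i   = subst (_< 1ℚ) (sym ([]≔-distance-there j≢i)) (close j j≢k)

adj⇔adj×near : ∀ {n} {G H : Graph n} {Near : Set} → SpanningSubgraph H G →
               ∀ u v → (Adj G u v → (Adj H u v ⇔ Near)) → Adj H u v ⇔ (Adj G u v × Near)
adj⇔adj×near H⊆G u v near⇔ = mk⇔
  (λ uv∈H → H⊆G uv∈H , Equivalence.to (near⇔ (H⊆G uv∈H)) uv∈H)
  (λ (uv∈G , near) → Equivalence.from (near⇔ uv∈G) near)

lemma7 : ∀ {n : ℕ} (G : Graph n) →
         (∃[ pos ] (IsUnitCubeContactRep G pos × CoplanarFaces pos)) →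
         ∀ (H : Graph n) → IsThresholdSubgraph H G → HasUnitCubeContactRep H
lemma7 {n} G (pos , (disjoint , contact) , i , _ , onPlane) H (H⊆G , _ , t , c , _ , _ , threshold) =
  lifted , (λ u v u≢v → interiorDisjoint-[]≔ (coplanar u v) (disjoint u v u≢v)) , adjacency
  where
  lifted : Fin n → Point
  lifted v = pos v [ i ]≔ scale t (c v)

  coplanar : ∀ u v → pos u i ≡ pos v i
  coplanar u v = trans (onPlane u) (sym (onPlane v))

  adjacency : ∀ u v → u ≢ v → Adj H u v ⇔ FaceContact (lifted u) (lifted v)
  adjacency u v u≢v =
    ⇔.trans (adj⇔adj×near {G = G} {H = H} H⊆G u v (threshold u v))
    (⇔.trans (contact u v u≢v ×-⇔ ⇔.sym (∣scale-scale∣<1⇔ t (c u) (c v)))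
             (⇔.sym (faceContact-[]≔ (coplanar u v) (disjoint u v u≢v))))
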